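{- Let $G$ be an undirected graph with terminals $s,t$ in which every vertex has degree at most $\delta$. Consider the following algorithm: first repeatedly delete every vertex and every edge of $G$ that does not lie on any $s$-$t$ path; then compute a feedback vertex set $S$ of the resulting graph whose size is at most twice the minimum size of a feedback vertex set; then return $T=S\cup\bigcup_{v\in S}N(v)$. Then $T$ is a tracking set for $(G,s,t)$ and $|T|\le 2(\delta+1)\cdot\mathrm{OPT}$, where $\mathrm{OPT}$ is the minimum size of a tracking set for $(G,s,t)$.
   Context: Graphs are finite, undirected and simple. A feedback vertex set is a set of vertices whose removal leaves an acyclic graph. $N(v)$ denotes the set of neighbours of $v$. An $s$-$t$ path is a simple path from $s$ to $t$. A set $T$ of vertices is a tracking set if for any two distinct $s$-$t$ paths $P_1,P_2$, the sequence of vertices of $T\cap V(P_1)$ in the order along $P_1$ differs from that of $T\cap V(P_2)$ along $P_2$. -}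

module Defs where

open import Data.Nat using (ℕ; _≤_; _*_; _+_)
open import Data.Fin using (Fin)
open import Data.Fin.Subset using (Subset; _∈_; _∉_; ∣_∣)
open import Data.Fin.Subset.Properties using (_∈?_)
open import Data.Bool using (Bool; true; false)
open import Data.Vec using (tabulate)
open import Data.List using (List; []; _∷_; _++_; [_]; head; last; filter; length)
open import Data.List.Relation.Unary.Linked using (Linked)
open import Data.List.Relation.Unary.Unique.Propositional using (Unique)
open import Data.List.Relation.Unary.All using (All)
import Data.List.Membership.Propositional as LM
open import Data.Maybe using (just)
open import Data.Product using (Σ; ∃; _×_; _,_)
open import Data.Sum using (_⊎_)
open import Relation.Binary.PropositionalEquality using (_≡_; _≢_)
open import Relation.Nullary using (¬_)

record Graph (n : ℕ) : Set where
  field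
    adj   : Fin n → Fin n → Bool
    sym   : ∀ u v → adj u v ≡ adj v u
    irrefl : ∀ v → adj v v ≡ false

module _ {n : ℕ} (G : Graph n) where
  open Graph G

  Adj : Fin n → Fin n → Set
  Adj u v = adj u v ≡ true

  degree : Fin n → ℕ
  degree v = ∣ tabulate (adj v) ∣

  IsPath : Fin n → Fin n → List (Fin n) → Set
  IsPath s t P = Unique P × Linked Adj P × head P ≡ just s × last P ≡ just t

  trace : Subset n → List (Fin n) → List (Fin n)
  trace T P = filter (_∈? T) P

  IsTrackingSet : Fin n → Fin n → Subset n → Set
  IsTrackingSet s t T = ∀ P₁ P₂ → IsPath s t P₁ → IsPath s t P₂ → P₁ ≢ P₂ →
                        trace T P₁ ≢ trace T P₂

  -- The graph obtained by deleting every vertex and every edge not lying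
  -- on any s-t path.
  RVert : Fin n → Fin n → Fin n → Set
  RVert s t v = ∃ λ P → IsPath s t P × v LM.∈ P

  REdge : Fin n → Fin n → Fin n → Fin n → Set
  REdge s t u v = ∃ λ P → IsPath s t P ×
    ((∃ λ xs → ∃ λ ys → P ≡ xs ++ u ∷ v ∷ ys) ⊎
     (∃ λ xs → ∃ λ ys → P ≡ xs ++ v ∷ u ∷ ys))

  CycleAvoiding : Fin n → Fin n → Subset n → Set
  CycleAvoiding s t S = ∃ λ x → ∃ λ xs → 2 ≤ length xs × Unique (x ∷ xs) ×
    Linked (REdge s t) (x ∷ xs ++ [ x ]) × All (_∉ S) (x ∷ xs)

  IsFVS : Fin n → Fin n → Subset n → Set
  IsFVS s t S = (∀ v → v ∈ S → RVert s t v) × ¬ CycleAvoiding s t S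

-- Two distinct s-t paths
-- agree up to a vertex u and then continue to different vertices a and b. If u ∈ S,
-- then a, b ∈ T and the traces differ at once. Otherwise follow both paths to their
-- first vertex in T: if the traces agree, this vertex is common to both (or neither
-- path meets T and both reach t), and the two segments close a cycle of the reduced
-- graph avoiding S, unless that vertex lies in S, in which case its predecessors on
-- both paths are in T, so both segments are single edges and a = b.
-- Conversely, if T′ is any tracking set then T′ restricted to the reduced graph is a
-- feedback vertex set: a reduced cycle C avoiding T′ meets some s-t path P in two
-- vertices, and replacing the part of P between its first and last vertex on C by
-- either arc of C gives two distinct s-t paths with the same trace.
-- Hence |S| ≤ 2|T′| for every tracking set T′, while |T| ≤ (δ + 1)|S|.

module Submission where

open import Defs
open import Level using (0ℓ)
open import Data.Nat using (ℕ; zero; suc; _≤_; _*_; _+_; s≤s; z≤n; _≤?_)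
open import Data.Nat.Properties
  using (≤-trans; ≤-reflexive; m≤n+m; n≤1+n; suc-injective; +-suc; +-monoʳ-≤; +-mono-≤; *-monoˡ-≤; *-monoʳ-≤;
         module ≤-Reasoning)
open import Data.Nat.Tactic.RingSolver using (solve-∀)
open import Data.Bool using (true)
open import Data.Fin using (Fin; zero; suc) renaming (_≟_ to _≟ᶠ_)
open import Data.Vec using ([]; _∷_; tabulate; here; there)
open import Data.Vec.Properties using (lookup∘tabulate; []=⇒lookup; lookup⇒[]=)
open import Data.List using (List; []; _∷_; _++_; [_]; _∷ʳ_; reverse; _ʳ++_; head; last; length; map)
open import Data.List.Properties
  using (++-assoc; ++-identityʳ; reverse-++; unfold-reverse; length-++; length-reverse; length-map;
         filter-++; filter-none; filter-accept; ++-cancelˡ; ++-cancelʳ; ∷-injectiveˡ; ∷-injectiveʳ; ∷ʳ-injective)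
open import Data.List.Relation.Unary.All as All using (All; []; _∷_)
import Data.List.Relation.Unary.All.Properties as All
open import Data.List.Relation.Unary.Any using (Any; here; there; any?)
open import Data.List.Relation.Unary.Any.Properties using (reverse⁺; reverse⁻)
open import Data.List.Relation.Unary.AllPairs using ([]; _∷_)
open import Data.List.Relation.Unary.First using (FirstView; first) renaming (_++_∷_ to firstAt)
open import Data.List.Relation.Unary.First.Properties using (toView)
open import Data.List.Relation.Unary.Linked as Linked using (Linked; []; [-]; _∷_)
open import Data.List.Relation.Unary.Unique.Propositional using (Unique)
import Data.List.Relation.Unary.Unique.Propositional.Properties as Unique
open import Data.List.Relation.Binary.Disjoint.Propositional using (Disjoint)
open import Data.List.Relation.Binary.Subset.Propositional using (_⊆_)
open import Data.List.Relation.Binary.Permutation.Propositional using (_↭_; ↭-sym; ↭⇒↭ₛ)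
open import Data.List.Relation.Binary.Permutation.Propositional.Properties
  using (↭-reverse; shifts; ∈-resp-↭; ↭-length)
import Data.List.Relation.Binary.Permutation.Propositional.Properties as ↭
import Data.List.Relation.Binary.Permutation.Setoid.Properties as Permutationₛ
open import Data.List.Membership.Propositional.Properties using (∈-++⁺ˡ; ∈-++⁺ʳ; ∈-++⁻; ∈-∃++; ∈-map⁺)
import Data.List.Membership.DecPropositional as DecMembership
open import Data.Maybe using (just)
open import Data.Maybe.Properties using (just-injective)
open import Data.Product using (∃; ∃₂; _×_; _,_; proj₁; proj₂)
open import Data.Empty using (⊥)
open import Data.Sum as Sum using (_⊎_; inj₁; inj₂)
open import Function using (_∘_)
open import Function.Bundles using (_⇔_; Equivalence)
open import Relation.Binary using (Rel; Symmetric; DecidableEquality)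
open import Relation.Binary.PropositionalEquality
  using (_≡_; _≢_; refl; sym; trans; cong; subst; setoid; module ≡-Reasoning)
open import Relation.Nullary using (¬_; yes; no; does; contradiction)
open import Relation.Nullary.Negation using (¬¬-map)
open import Relation.Nullary.Decidable using (toSum; decidable-stable; ¬¬-excluded-middle; dec-true)
open import Relation.Unary using (Pred; Decidable; ∁)

-- Lists, walks and cycles

module _ {A : Set} where

  open import Data.List.Membership.Propositional using (_∈_; lose)

  Unique-resp-↭ : ∀ {xs ys : List A} → xs ↭ ys → Unique xs → Unique ys
  Unique-resp-↭ = Permutationₛ.Unique-resp-↭ (setoid A) ∘ ↭⇒↭ₛ

  Unique-++⁻ : ∀ (xs : List A) {ys} → Unique (xs ++ ys) → Unique xs × Unique ys × Disjoint xs ys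
  Unique-++⁻ [] u = [] , u , λ ()
  Unique-++⁻ (x ∷ xs) (x∉ ∷ u) with Unique-++⁻ xs u
  ... | uxs , uys , dis = All.++⁻ˡ xs x∉ ∷ uxs , uys , disjoint
    where
    disjoint : Disjoint (x ∷ xs) _
    disjoint (here refl , v∈ys) = All.lookup (All.++⁻ʳ xs x∉) v∈ys refl
    disjoint (there v∈xs , v∈ys) = dis (v∈xs , v∈ys)

  Unique-prefix : ∀ (xs : List A) {w ys} → Unique (xs ++ w ∷ ys) → Unique (xs ∷ʳ w)
  Unique-prefix xs {w} {ys} u = proj₁ (Unique-++⁻ (xs ∷ʳ w) (subst Unique (sym (++-assoc xs [ w ] ys)) u))

  Unique-reverse : ∀ {xs : List A} → Unique xs → Unique (reverse xs)
  Unique-reverse {xs} = Unique-resp-↭ (↭-sym (↭-reverse xs))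

  Unique-replace : ∀ (xs ys zs : List A) {ys′} → Unique (xs ++ ys ++ zs) → Unique ys′ →
                   Disjoint ys′ (xs ++ zs) → Unique (xs ++ ys′ ++ zs)
  Unique-replace xs ys zs {ys′} u u′ dis =
    Unique-resp-↭ (↭-sym (shifts xs ys′))
      (Unique.++⁺ u′ (proj₁ (proj₂ (Unique-++⁻ ys (Unique-resp-↭ (shifts xs ys) u)))) dis)

  reverse-∷-∷ʳ : ∀ (x : A) xs y → reverse (x ∷ xs ∷ʳ y) ≡ y ∷ reverse xs ∷ʳ x
  reverse-∷-∷ʳ x xs y = trans (reverse-++ (x ∷ xs) [ y ]) (cong (y ∷_) (unfold-reverse x xs))

  head-++-∷ : ∀ (xs : List A) {y ys zs} → head (xs ++ y ∷ ys) ≡ head (xs ++ y ∷ zs)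
  head-++-∷ [] = refl
  head-++-∷ (x ∷ xs) = refl

  last-++-∷ : ∀ (xs : List A) {y ys} → last (xs ++ y ∷ ys) ≡ last (y ∷ ys)
  last-++-∷ [] = refl
  last-++-∷ (x ∷ []) = refl
  last-++-∷ (x ∷ x′ ∷ xs) = last-++-∷ (x′ ∷ xs)

  last-detour : ∀ (pre : List A) {f} M {l} post → last (pre ++ (f ∷ M ∷ʳ l) ++ post) ≡ last (l ∷ post)
  last-detour pre {f} M {l} post = trans (cong last eq) (last-++-∷ (pre ++ f ∷ M))
    where
    eq : pre ++ (f ∷ M ∷ʳ l) ++ post ≡ (pre ++ f ∷ M) ++ l ∷ post
    eq = trans (cong (λ ys → pre ++ f ∷ ys) (++-assoc M [ l ] post)) (sym (++-assoc pre (f ∷ M) (l ∷ post)))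

  last-∈ : ∀ {xs : List A} {z} → last xs ≡ just z → z ∈ xs
  last-∈ {x ∷ []} refl = here refl
  last-∈ {x ∷ x′ ∷ xs} eq = there (last-∈ eq)

  SimpleWalk : Rel A 0ℓ → List A → Set
  SimpleWalk R xs = Unique xs × Linked R xs

  IsCycle : Rel A 0ℓ → A → List A → Set
  IsCycle R x xs = 2 ≤ length xs × Unique (x ∷ xs) × Linked R (x ∷ xs ∷ʳ x)

  IsArc : Rel A 0ℓ → List A → A → A → List A → Set
  IsArc R C f l D = SimpleWalk R (f ∷ D ∷ʳ l) × f ∷ D ∷ʳ l ⊆ C

  module _ {R : Rel A 0ℓ} where

    Linked-++⁻ : ∀ xs {w ys} → Linked R (xs ++ w ∷ ys) → Linked R (xs ∷ʳ w) × Linked R (w ∷ ys)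
    Linked-++⁻ [] l = [-] , l
    Linked-++⁻ (x ∷ []) (r ∷ l) = r ∷ [-] , l
    Linked-++⁻ (x ∷ x′ ∷ xs) (r ∷ l) with Linked-++⁻ (x′ ∷ xs) l
    ... | l₁ , l₂ = r ∷ l₁ , l₂

    Linked-++⁺ : ∀ xs {w ys} → Linked R (xs ∷ʳ w) → Linked R (w ∷ ys) → Linked R (xs ++ w ∷ ys)
    Linked-++⁺ [] _ l = l
    Linked-++⁺ (x ∷ []) (r ∷ _) l = r ∷ l
    Linked-++⁺ (x ∷ x′ ∷ xs) (r ∷ l₁) l = r ∷ Linked-++⁺ (x′ ∷ xs) l₁ l

    Linked-infix⁺ : ∀ {zs} → (∀ xs {u v} ys → zs ≡ xs ++ u ∷ v ∷ ys → R u v) → Linked R zs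
    Linked-infix⁺ {[]} _ = []
    Linked-infix⁺ {x ∷ []} _ = [-]
    Linked-infix⁺ {x ∷ y ∷ zs} r = r [] zs refl ∷ Linked-infix⁺ λ xs ys eq → r (x ∷ xs) ys (cong (x ∷_) eq)

    Linked-infix⁻ : ∀ xs {u v ys} → Linked R (xs ++ u ∷ v ∷ ys) → R u v
    Linked-infix⁻ xs l with Linked-++⁻ xs l
    ... | _ , r ∷ _ = r

    Linked-replace : ∀ xs {f M l D} zs → Linked R (xs ++ (f ∷ M ∷ʳ l) ++ zs) → Linked R (f ∷ D ∷ʳ l) →
                     Linked R (xs ++ (f ∷ D ∷ʳ l) ++ zs)
    Linked-replace [] {f} {M} {l} {D} zs old arc =
      subst (Linked R) (sym (++-assoc (f ∷ D) [ l ] zs))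
        (Linked-++⁺ (f ∷ D) arc (proj₂ (Linked-++⁻ (f ∷ M) (subst (Linked R) (++-assoc (f ∷ M) [ l ] zs) old))))
    Linked-replace (x ∷ []) zs (r ∷ old) arc = r ∷ Linked-replace [] zs old arc
    Linked-replace (x ∷ x′ ∷ xs) zs (r ∷ old) arc = r ∷ Linked-replace (x′ ∷ xs) zs old arc

    Linked-∷ʳ⇒sources : ∀ xs {y} → Linked R (xs ∷ʳ y) → All (λ v → ∃ (R v)) xs
    Linked-∷ʳ⇒sources [] _ = []
    Linked-∷ʳ⇒sources (x ∷ []) (r ∷ _) = (_ , r) ∷ []
    Linked-∷ʳ⇒sources (x ∷ x′ ∷ xs) (r ∷ l) = (_ , r) ∷ Linked-∷ʳ⇒sources (x′ ∷ xs) l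

    SimpleWalk-++⁻ : ∀ xs {w ys} → SimpleWalk R (xs ++ w ∷ ys) → SimpleWalk R (xs ∷ʳ w) × SimpleWalk R (w ∷ ys)
    SimpleWalk-++⁻ xs (u , l) =
      (Unique-prefix xs u , proj₁ (Linked-++⁻ xs l)) , (proj₁ (proj₂ (Unique-++⁻ xs u)) , proj₂ (Linked-++⁻ xs l))

  firstView? : {Q : Pred A 0ℓ} → Decidable Q → ∀ xs → FirstView (∁ Q) Q xs ⊎ All (∁ Q) xs
  firstView? Q? = Sum.map₁ toView ∘ first (λ x → Sum.swap (toSum (Q? x)))

  data LastView (Q : Pred A 0ℓ) : List A → Set where
    lastAt : ∀ xs {y} → Q y → ∀ {ys} → All (∁ Q) ys → LastView Q (xs ++ y ∷ ys)

  lastView : {Q : Pred A 0ℓ} → Decidable Q → ∀ {xs} → Any Q xs → LastView Q xs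
  lastView Q? {x ∷ xs} q with any? Q? xs
  ... | yes q′ with lastView Q? q′
  ...   | lastAt ys qy ¬Q[rest] = lastAt (x ∷ ys) qy ¬Q[rest]
  lastView Q? {x ∷ xs} (here qx) | no ¬q = lastAt [] qx (All.¬Any⇒All¬ xs ¬q)
  lastView Q? {x ∷ xs} (there q) | no ¬q = contradiction q ¬q

  data Fork : List A → List A → Set where
    fork : ∀ pre u {a b} → a ≢ b → ∀ R₁ R₂ → Fork (pre ++ u ∷ a ∷ R₁) (pre ++ u ∷ b ∷ R₂)

  Fork-∷ : ∀ {x xs ys} → Fork xs ys → Fork (x ∷ xs) (x ∷ ys)
  Fork-∷ {x} (fork pre u a≢b R₁ R₂) = fork (x ∷ pre) u a≢b R₁ R₂

  data Outermost (Q : Pred A 0ℓ) : List A → Set where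
    outermost : ∀ {pre} → All (∁ Q) pre → ∀ {f} → Q f → ∀ M {l} → Q l → f ≢ l →
                ∀ {post} → All (∁ Q) post → Outermost Q (pre ++ (f ∷ M ∷ʳ l) ++ post)

  module _ (_≟_ : DecidableEquality A) where

    -- Uniqueness and the common last vertex rule out that one list is a proper prefix of the other.
    diverge : ∀ {xs ys} → xs ≢ ys → head xs ≡ head ys → last xs ≡ last ys →
              Unique xs → Unique ys → Fork xs ys
    diverge {[]} {[]} xs≢ys _ _ _ _ = contradiction refl xs≢ys
    diverge {x ∷ []} {x ∷ []} xs≢ys refl _ _ _ = contradiction refl xs≢ys
    diverge {x ∷ []} {x ∷ _ ∷ _} _ refl lasts _ (x∉ ∷ _) = contradiction refl (All.lookup x∉ (last-∈ (sym lasts)))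
    diverge {x ∷ _ ∷ _} {x ∷ []} _ refl lasts (x∉ ∷ _) _ = contradiction refl (All.lookup x∉ (last-∈ lasts))
    diverge {x ∷ a ∷ xs} {x ∷ b ∷ ys} xs≢ys refl lasts (_ ∷ u₁) (_ ∷ u₂) with a ≟ b
    ... | no a≢b = fork [] x a≢b xs ys
    ... | yes refl = Fork-∷ (diverge (xs≢ys ∘ cong (x ∷_)) refl lasts u₁ u₂)

    module _ {Q : Pred A 0ℓ} (Q? : Decidable Q) where

      private
        Q-after : ∀ pre {f rest v} → All (∁ Q) pre → v ∈ pre ++ f ∷ rest → Q v → v ≢ f → Any Q rest
        Q-after pre ¬Q[pre] v∈ qv v≢f with ∈-++⁻ pre v∈
        ... | inj₁ v∈pre = contradiction qv (All.lookup ¬Q[pre] v∈pre)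
        ... | inj₂ (here refl) = contradiction refl v≢f
        ... | inj₂ (there v∈rest) = lose v∈rest qv

        Q-in-rest : ∀ pre {f rest x y} → All (∁ Q) pre → x ∈ pre ++ f ∷ rest → y ∈ pre ++ f ∷ rest →
                    x ≢ y → Q x → Q y → Any Q rest
        Q-in-rest pre {f} {x = x} ¬Q[pre] x∈ y∈ x≢y qx qy with x ≟ f
        ... | yes refl = Q-after pre ¬Q[pre] y∈ qy (x≢y ∘ sym)
        ... | no x≢f = Q-after pre ¬Q[pre] x∈ qx x≢f

      outermostView : ∀ {P} → Unique P → ∀ {x y} → x ∈ P → y ∈ P → x ≢ y → Q x → Q y → Outermost Q P
      outermostView {P} uP x∈P y∈P x≢y qx qy with firstView? Q? P
      ... | inj₂ ¬Q[P] = contradiction qx (All.lookup ¬Q[P] x∈P)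
      ... | inj₁ (firstAt {pre} {f} ¬Q[pre] qf rest) with lastView Q? (Q-in-rest pre ¬Q[pre] x∈P y∈P x≢y qx qy)
      ...   | lastAt M {l} ql {post} ¬Q[post] =
        subst (Outermost Q) (cong (λ ys → pre ++ f ∷ ys) (++-assoc M [ l ] post))
          (outermost ¬Q[pre] qf M ql f≢l ¬Q[post])
        where
        f≢l : f ≢ l
        f≢l refl = Unique.Unique[x∷xs]⇒x∉xs (proj₁ (proj₂ (Unique-++⁻ pre uP))) (∈-++⁺ʳ M (here refl))

  module _ {R : Rel A 0ℓ} (R-sym : Symmetric R) where

    Linked-reverse : ∀ {xs} → Linked R xs → Linked R (reverse xs)
    Linked-reverse [] = []
    Linked-reverse [-] = [-]
    Linked-reverse l@(_ ∷ _) = ʳ++⁺ l [-]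
      where
      ʳ++⁺ : ∀ {y xs acc} → Linked R (y ∷ xs) → Linked R (y ∷ acc) → Linked R ((y ∷ xs) ʳ++ acc)
      ʳ++⁺ [-] lacc = lacc
      ʳ++⁺ (r ∷ l) lacc = ʳ++⁺ l (R-sym r ∷ lacc)

    SimpleWalk-reverse : ∀ {xs} → SimpleWalk R xs → SimpleWalk R (reverse xs)
    SimpleWalk-reverse (u , l) = Unique-reverse u , Linked-reverse l

    private
      cycle-length : ∀ (X : List A) {w} Y → ¬ (X ≡ [] × Y ≡ []) → 2 ≤ length (X ++ w ∷ reverse Y)
      cycle-length [] [] nonTrivial = contradiction (refl , refl) nonTrivial
      cycle-length [] (y ∷ Y) _ rewrite length-reverse (y ∷ Y) = s≤s (s≤s z≤n)
      cycle-length (x ∷ X) {w} Y _ rewrite length-++ X {w ∷ reverse Y} =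
        s≤s (≤-trans (s≤s z≤n) (m≤n+m _ (length X)))

    disjointWalks⇒cycle : ∀ {u w} (X Y : List A) → ¬ (X ≡ [] × Y ≡ []) → Disjoint X Y →
                     SimpleWalk R (u ∷ X ∷ʳ w) → SimpleWalk R (u ∷ Y ∷ʳ w) → IsCycle R u (X ++ w ∷ reverse Y)
    disjointWalks⇒cycle {u} {w} X Y nonTrivial X∩Y=∅ (uX , lX) (uY , lY) =
      cycle-length X Y nonTrivial , unique , linked
      where
      uY-parts = Unique-++⁻ (u ∷ Y) uY

      disjoint : Disjoint (u ∷ X ∷ʳ w) (reverse Y)
      disjoint (here refl , v∈rY) with proj₁ uY-parts
      ... | u∉Y ∷ _ = All.lookup u∉Y (reverse⁻ v∈rY) refl
      disjoint (there v∈ , v∈rY) with ∈-++⁻ X v∈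
      ... | inj₁ v∈X = X∩Y=∅ (v∈X , reverse⁻ v∈rY)
      ... | inj₂ (here refl) = proj₂ (proj₂ uY-parts) (there (reverse⁻ v∈rY) , here refl)

      unique : Unique (u ∷ X ++ w ∷ reverse Y)
      unique with proj₁ uY-parts
      ... | _ ∷ uY′ = subst (Unique ∘ (u ∷_)) (++-assoc X [ w ] (reverse Y))
                            (Unique.++⁺ uX (Unique-reverse uY′) disjoint)

      linked : Linked R (u ∷ (X ++ w ∷ reverse Y) ∷ʳ u)
      linked = subst (Linked R ∘ (u ∷_)) (sym (++-assoc X (w ∷ reverse Y) [ u ]))
                 (Linked-++⁺ (u ∷ X) lX (subst (Linked R) (reverse-∷-∷ʳ u Y w) (Linked-reverse lY)))

    module _ (_≟_ : DecidableEquality A) where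
      open DecMembership _≟_ using (_∈?_)

      rejoiningWalks⇒cycle : ∀ {u Q₁ Q₂ z} → SimpleWalk R (u ∷ Q₁) → SimpleWalk R (u ∷ Q₂) →
                              head Q₁ ≢ head Q₂ → z ∈ Q₁ → z ∈ Q₂ →
                              ∃₂ λ x xs → IsCycle R x xs × x ∷ xs ⊆ u ∷ Q₁ ++ Q₂
      rejoiningWalks⇒cycle {u} {Q₁} {Q₂} w₁ w₂ heads≢ z∈Q₁ z∈Q₂ with firstView? (_∈? Q₂) Q₁
      ... | inj₂ Q₁∩Q₂=∅ = contradiction z∈Q₂ (All.lookup Q₁∩Q₂=∅ z∈Q₁)
      ... | inj₁ (firstAt {X} {w} X∩Q₂=∅ w∈Q₂ W₁) with ∈-∃++ w∈Q₂
      ...   | Y , W₂ , refl =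
        u , X ++ w ∷ reverse Y ,
        disjointWalks⇒cycle X Y (λ { (refl , refl) → heads≢ refl })
          (λ (v∈X , v∈Y) → All.lookup X∩Q₂=∅ v∈X (∈-++⁺ˡ v∈Y))
          (proj₁ (SimpleWalk-++⁻ (u ∷ X) w₁)) (proj₁ (SimpleWalk-++⁻ (u ∷ Y) w₂)) ,
        ⊆-union
        where
        ⊆-union : u ∷ X ++ w ∷ reverse Y ⊆ u ∷ (X ++ w ∷ W₁) ++ Y ++ w ∷ W₂
        ⊆-union (here refl) = here refl
        ⊆-union (there v∈) with ∈-++⁻ X v∈
        ... | inj₁ v∈X = there (∈-++⁺ˡ (∈-++⁺ˡ v∈X))
        ... | inj₂ (here refl) = there (∈-++⁺ˡ (∈-++⁺ʳ X (here refl)))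
        ... | inj₂ (there v∈rY) = there (∈-++⁺ʳ (X ++ w ∷ W₁) (∈-++⁺ˡ (reverse⁻ {xs = Y} v∈rY)))

    IsCycle-rotate : ∀ {x xs} α {f} β → x ∷ xs ≡ α ++ f ∷ β → IsCycle R x xs →
                     IsCycle R f (β ++ α) × f ∷ β ++ α ↭ x ∷ xs
    IsCycle-rotate {x} {xs} α {f} β eq (len , uniq , closed) =
      (subst (2 ≤_) (suc-injective (sym (↭-length perm))) len ,
       Unique-resp-↭ (↭-sym perm) uniq ,
       linked α eq closed) ,
      perm
      where
      perm : f ∷ β ++ α ↭ x ∷ xs
      perm = subst (f ∷ β ++ α ↭_) (sym eq) (↭.++-comm (f ∷ β) α)

      linked : ∀ α {x xs} → x ∷ xs ≡ α ++ f ∷ β → Linked R (x ∷ xs ∷ʳ x) → Linked R (f ∷ (β ++ α) ∷ʳ f)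
      linked [] refl closed = subst (λ ys → Linked R (f ∷ ys ∷ʳ f)) (sym (++-identityʳ β)) closed
      linked (a ∷ α′) refl closed
        with Linked-++⁻ (a ∷ α′) (subst (Linked R ∘ (a ∷_)) (++-assoc α′ (f ∷ β) [ a ]) closed)
      ... | a⋯f , f⋯a =
        subst (Linked R ∘ (f ∷_)) (sym (++-assoc β (a ∷ α′) [ f ])) (Linked-++⁺ (f ∷ β) f⋯a a⋯f)

    private
      palindromic-split : ∀ {δ : List A} {l ε} → Disjoint δ (l ∷ ε) → δ ≡ reverse ε → δ ++ l ∷ ε ≡ [ l ]
      palindromic-split {ε = []} _ refl = refl
      palindromic-split {ε = e ∷ ε} δ∩ε=∅ refl =
        contradiction (reverse⁺ {xs = e ∷ ε} (here refl) , there (here refl)) δ∩ε=∅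

    IsCycle⇒headArcs : ∀ {f ys l} → IsCycle R f ys → l ∈ ys →
                       ∃₂ λ D₁ D₂ → D₁ ≢ D₂ × IsArc R (f ∷ ys) f l D₁ × IsArc R (f ∷ ys) f l D₂
    IsCycle⇒headArcs {f} (len , f∉ ∷ uniq , closed) l∈ys with ∈-∃++ l∈ys
    ... | δ , ε , refl = δ , reverse ε , distinct , (forward , ⊆-forward) , (backward , ⊆-backward)
      where
      δ-parts = Unique-++⁻ δ uniq
      halves = Linked-++⁻ (f ∷ δ) (subst (Linked R ∘ (f ∷_)) (++-assoc δ (_ ∷ ε) [ f ]) closed)

      distinct : δ ≢ reverse ε
      distinct δ≡rε with subst (λ zs → 2 ≤ length zs) (palindromic-split (proj₂ (proj₂ δ-parts)) δ≡rε) len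
      ... | s≤s ()

      forward : SimpleWalk R (f ∷ δ ∷ʳ _)
      forward = Unique-prefix (f ∷ δ) (f∉ ∷ uniq) , proj₁ halves

      backward : SimpleWalk R (f ∷ reverse ε ∷ʳ _)
      backward = subst (SimpleWalk R) (reverse-∷-∷ʳ _ ε f)
        (SimpleWalk-reverse (Unique.++⁺ (proj₁ (proj₂ δ-parts)) ([] ∷ []) f∉l∷ε , proj₂ halves))
        where
        f∉l∷ε : Disjoint (_ ∷ ε) [ f ]
        f∉l∷ε (v∈ , here refl) = All.lookup f∉ (∈-++⁺ʳ δ v∈) refl

      ⊆-forward : f ∷ δ ∷ʳ _ ⊆ f ∷ δ ++ _ ∷ ε
      ⊆-forward (here refl) = here refl
      ⊆-forward (there v∈) with ∈-++⁻ δ v∈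
      ... | inj₁ v∈δ = there (∈-++⁺ˡ v∈δ)
      ... | inj₂ (here refl) = there (∈-++⁺ʳ δ (here refl))

      ⊆-backward : f ∷ reverse ε ∷ʳ _ ⊆ f ∷ δ ++ _ ∷ ε
      ⊆-backward (here refl) = here refl
      ⊆-backward (there v∈) with ∈-++⁻ (reverse ε) v∈
      ... | inj₁ v∈ε = there (∈-++⁺ʳ δ (there (reverse⁻ v∈ε)))
      ... | inj₂ (here refl) = there (∈-++⁺ʳ δ (here refl))

    IsCycle⇒arcs : ∀ {x xs f l} → IsCycle R x xs → f ∈ x ∷ xs → l ∈ x ∷ xs → f ≢ l →
                 ∃₂ λ D₁ D₂ → D₁ ≢ D₂ × IsArc R (x ∷ xs) f l D₁ × IsArc R (x ∷ xs) f l D₂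
    IsCycle⇒arcs cycle f∈ l∈ f≢l with ∈-∃++ f∈
    ... | α , β , eq with IsCycle-rotate α β eq cycle
    ...   | cycle′ , perm with IsCycle⇒headArcs cycle′ (l∈β++α (∈-resp-↭ (↭-sym perm) l∈))
      where
      l∈β++α : _ ∈ _ ∷ β ++ α → _ ∈ β ++ α
      l∈β++α (here refl) = contradiction refl f≢l
      l∈β++α (there l∈) = l∈
    ...     | D₁ , D₂ , D₁≢D₂ , (w₁ , ⊆₁) , (w₂ , ⊆₂) =
      D₁ , D₂ , D₁≢D₂ , (w₁ , ∈-resp-↭ perm ∘ ⊆₁) , (w₂ , ∈-resp-↭ perm ∘ ⊆₂)

-- Subsets of Fin n

open import Data.Fin.Subset using (Subset; _∈_; _∉_; ∣_∣; _∪_; _∩_; ⁅_⁆; ⋃; inside; outside)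
open import Data.Fin.Subset.Properties
  using (_∈?_; x∈⁅x⁆; x∈p∪q⁺; x∈p∩q⁺; x∈p∩q⁻; ∣⊥∣≡0; ∣⁅x⁆∣≡1; ∣p∩q∣≤∣p∣; p⊆q⇒∣p∣≤∣q∣)
open import Data.List.Membership.Propositional using () renaming (_∈_ to _∈ₗ_)

elements : ∀ {n} → Subset n → List (Fin n)
elements [] = []
elements (inside ∷ p) = zero ∷ map suc (elements p)
elements (outside ∷ p) = map suc (elements p)

length-elements : ∀ {n} (p : Subset n) → length (elements p) ≡ ∣ p ∣
length-elements [] = refl
length-elements (inside ∷ p) = cong suc (trans (length-map suc (elements p)) (length-elements p))
length-elements (outside ∷ p) = trans (length-map suc (elements p)) (length-elements p)

∈-elements : ∀ {n} {p : Subset n} {v} → v ∈ p → v ∈ₗ elements p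
∈-elements {p = inside ∷ p} here = here refl
∈-elements {p = inside ∷ p} (there v∈p) = there (∈-map⁺ suc (∈-elements v∈p))
∈-elements {p = outside ∷ p} (there v∈p) = ∈-map⁺ suc (∈-elements v∈p)

∣p∪q∣≤∣p∣+∣q∣ : ∀ {n} (p q : Subset n) → ∣ p ∪ q ∣ ≤ ∣ p ∣ + ∣ q ∣
∣p∪q∣≤∣p∣+∣q∣ [] [] = z≤n
∣p∪q∣≤∣p∣+∣q∣ (inside ∷ p) (inside ∷ q) =
  s≤s (≤-trans (∣p∪q∣≤∣p∣+∣q∣ p q) (+-monoʳ-≤ ∣ p ∣ (n≤1+n ∣ q ∣)))
∣p∪q∣≤∣p∣+∣q∣ (inside ∷ p) (outside ∷ q) = s≤s (∣p∪q∣≤∣p∣+∣q∣ p q)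
∣p∪q∣≤∣p∣+∣q∣ (outside ∷ p) (inside ∷ q) =
  subst (suc ∣ p ∪ q ∣ ≤_) (sym (+-suc ∣ p ∣ ∣ q ∣)) (s≤s (∣p∪q∣≤∣p∣+∣q∣ p q))
∣p∪q∣≤∣p∣+∣q∣ (outside ∷ p) (outside ∷ q) = ∣p∪q∣≤∣p∣+∣q∣ p q

module _ {n k : ℕ} (F : Fin n → Subset n) (∣F∣≤k : ∀ u → ∣ F u ∣ ≤ k) where

  ∣⋃∣≤ : ∀ us → ∣ ⋃ (map F us) ∣ ≤ length us * k
  ∣⋃∣≤ [] = ≤-reflexive (∣⊥∣≡0 n)
  ∣⋃∣≤ (u ∷ us) = ≤-trans (∣p∪q∣≤∣p∣+∣q∣ (F u) _) (+-mono-≤ (∣F∣≤k u) (∣⋃∣≤ us))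

  ∈-⋃ : ∀ {u v us} → u ∈ₗ us → v ∈ F u → v ∈ ⋃ (map F us)
  ∈-⋃ (here refl) v∈Fu = x∈p∪q⁺ (inj₁ v∈Fu)
  ∈-⋃ (there u∈us) v∈Fu = x∈p∪q⁺ (inj₂ (∈-⋃ u∈us v∈Fu))

  cover-bound : ∀ {S T} → (∀ {v} → v ∈ T → ∃ λ u → u ∈ S × v ∈ F u) → ∣ T ∣ ≤ ∣ S ∣ * k
  cover-bound {S} covered =
    ≤-trans (p⊆q⇒∣p∣≤∣q∣ T⊆⋃)
      (subst (λ m → ∣ ⋃ (map F (elements S)) ∣ ≤ m * k) (length-elements S) (∣⋃∣≤ (elements S)))
    where
    T⊆⋃ : ∀ {v} → v ∈ _ → v ∈ ⋃ (map F (elements S))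
    T⊆⋃ v∈T with covered v∈T
    ... | u , u∈S , v∈Fu = ∈-⋃ (∈-elements u∈S) v∈Fu

∈-tabulate⁺ : ∀ {n} (f : Fin n → _) {v} → f v ≡ true → v ∈ tabulate f
∈-tabulate⁺ f {v} fv = lookup⇒[]= v (tabulate f) (trans (lookup∘tabulate f v) fv)

∈-tabulate⁻ : ∀ {n} (f : Fin n → _) {v} → v ∈ tabulate f → f v ≡ true
∈-tabulate⁻ f {v} v∈ = trans (sym (lookup∘tabulate f v)) ([]=⇒lookup v∈)

¬¬-decidable : ∀ {n} (P : Pred (Fin n) 0ℓ) → ¬ ¬ Decidable P
¬¬-decidable {zero} P ¬P? = ¬P? λ ()
¬¬-decidable {suc n} P ¬P? = ¬¬-excluded-middle λ P0? → ¬¬-decidable (P ∘ suc) λ P′? →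
  ¬P? λ { zero → P0? ; (suc v) → P′? v }

-- The reduced graph

module _ {n : ℕ} (G : Graph n) (s t : Fin n) where

  open DecMembership (_≟ᶠ_ {n}) using () renaming (_∈?_ to _∈ₗ?_)

  consecutive⇒∈ : ∀ {P : List (Fin n)} {u v} →
                  (∃₂ λ xs ys → P ≡ xs ++ u ∷ v ∷ ys) ⊎ (∃₂ λ xs ys → P ≡ xs ++ v ∷ u ∷ ys) →
                  u ∈ₗ P × v ∈ₗ P
  consecutive⇒∈ (inj₁ (xs , _ , refl)) = ∈-++⁺ʳ xs (here refl) , ∈-++⁺ʳ xs (there (here refl))
  consecutive⇒∈ (inj₂ (xs , _ , refl)) = ∈-++⁺ʳ xs (there (here refl)) , ∈-++⁺ʳ xs (here refl)

  REdge-sym : Symmetric (REdge G s t)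
  REdge-sym (P , path , inj₁ at) = P , path , inj₂ at
  REdge-sym (P , path , inj₂ at) = P , path , inj₁ at

  REdge⇒Adj : ∀ {u v} → REdge G s t u v → Adj G u v
  REdge⇒Adj (_ , (_ , walk , _) , inj₁ (xs , _ , refl)) = Linked-infix⁻ xs walk
  REdge⇒Adj {u} {v} (_ , (_ , walk , _) , inj₂ (xs , _ , refl)) = trans (Graph.sym G u v) (Linked-infix⁻ xs walk)

  REdge⇒RVert : ∀ {u v} → REdge G s t u v → RVert G s t u
  REdge⇒RVert (P , path , at) = P , path , proj₁ (consecutive⇒∈ at)

  path⇒REdge-walk : ∀ {P} → IsPath G s t P → SimpleWalk (REdge G s t) P
  path⇒REdge-walk {P} path@(uniq , _) = uniq , Linked-infix⁺ λ xs ys eq → P , path , inj₁ (xs , ys , eq)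

  detour : ∀ pre {f M l D} post → IsPath G s t (pre ++ (f ∷ M ∷ʳ l) ++ post) →
           SimpleWalk (Adj G) (f ∷ D ∷ʳ l) → Disjoint (f ∷ D ∷ʳ l) (pre ++ post) →
           IsPath G s t (pre ++ (f ∷ D ∷ʳ l) ++ post)
  detour pre {f} {M} {l} {D} post (uniq , walk , starts , ends) (uniq′ , walk′) disjoint =
    Unique-replace pre (f ∷ M ∷ʳ l) post uniq uniq′ disjoint ,
    Linked-replace pre post walk walk′ ,
    trans (head-++-∷ pre) starts ,
    trans (last-detour pre D post) (trans (sym (last-detour pre M post)) ends)

  module _ (T : Subset n) where

    trace-∷-cancel : ∀ u {Q₁ Q₂} → trace G T (u ∷ Q₁) ≡ trace G T (u ∷ Q₂) →
                     trace G T Q₁ ≡ trace G T Q₂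
    trace-∷-cancel u eq with u ∈? T
    ... | yes _ = ∷-injectiveʳ eq
    ... | no _ = eq

    trace-cancel : ∀ pre {Q₁ Q₂} → trace G T (pre ++ Q₁) ≡ trace G T (pre ++ Q₂) →
                   trace G T Q₁ ≡ trace G T Q₂
    trace-cancel [] eq = eq
    trace-cancel (x ∷ pre) eq = trace-cancel pre (trace-∷-cancel x eq)

    trace-firstAt : ∀ {X y} W → All (_∉ T) X → y ∈ T → trace G T (X ++ y ∷ W) ≡ y ∷ trace G T W
    trace-firstAt {X} {y} W X∩T=∅ y∈T = begin
      trace G T (X ++ y ∷ W)             ≡⟨ filter-++ (_∈? T) X (y ∷ W) ⟩
      trace G T X ++ trace G T (y ∷ W)   ≡⟨ cong (_++ trace G T (y ∷ W)) (filter-none (_∈? T) X∩T=∅) ⟩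
      trace G T (y ∷ W)                  ≡⟨ filter-accept (_∈? T) y∈T ⟩
      y ∷ trace G T W                    ∎
      where open ≡-Reasoning

    trace-skip : ∀ pre {A} post → All (_∉ T) A → trace G T (pre ++ A ++ post) ≡ trace G T (pre ++ post)
    trace-skip pre {A} post A∩T=∅ = begin
      trace G T (pre ++ A ++ post)                 ≡⟨ filter-++ (_∈? T) pre (A ++ post) ⟩
      trace G T pre ++ trace G T (A ++ post)       ≡⟨ cong (trace G T pre ++_) (filter-++ (_∈? T) A post) ⟩
      trace G T pre ++ trace G T A ++ trace G T post
        ≡⟨ cong (λ zs → trace G T pre ++ zs ++ trace G T post) (filter-none (_∈? T) A∩T=∅) ⟩
      trace G T pre ++ trace G T post              ≡⟨ filter-++ (_∈? T) pre post ⟨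
      trace G T (pre ++ post)                      ∎
      where open ≡-Reasoning

  tracking⇒meetsCycles : ∀ {T} → IsTrackingSet G s t T →
                         ∀ {x xs} → IsCycle (REdge G s t) x xs → ¬ All (_∉ T) (x ∷ xs)
  tracking⇒meetsCycles {T} tracking {x} {y ∷ ys} cycle@(_ , x∉ ∷ _ , xy ∷ _) C∩T=∅ with xy
  ... | P , path , at with consecutive⇒∈ at
  ...   | x∈P , y∈P
    with outermostView _≟ᶠ_ (_∈ₗ? (x ∷ y ∷ ys)) (proj₁ path) x∈P y∈P (All.head x∉) (here refl) (there (here refl))
  ...     | outermost {pre} C∩pre=∅ f∈C M l∈C f≢l {post} C∩post=∅
    with IsCycle⇒arcs REdge-sym cycle f∈C l∈C f≢l
  ...       | D₁ , D₂ , D₁≢D₂ , arc₁ , arc₂ =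
    tracking _ _ (reroute arc₁) (reroute arc₂) (D₁≢D₂ ∘ interiors-equal)
      (trans (trace-skip T pre post (avoids arc₁)) (sym (trace-skip T pre post (avoids arc₂))))
    where
    reroute : ∀ {D} → IsArc (REdge G s t) (x ∷ y ∷ ys) _ _ D → IsPath G s t (pre ++ (_ ∷ D ∷ʳ _) ++ post)
    reroute (walk , ⊆C) = detour pre post path (proj₁ walk , Linked.map REdge⇒Adj (proj₂ walk)) disjoint
      where
      disjoint : Disjoint _ (pre ++ post)
      disjoint (v∈arc , v∈pre++post) with ∈-++⁻ pre v∈pre++post
      ... | inj₁ v∈pre = All.lookup C∩pre=∅ v∈pre (⊆C v∈arc)
      ... | inj₂ v∈post = All.lookup C∩post=∅ v∈post (⊆C v∈arc)

    avoids : ∀ {D} → IsArc (REdge G s t) (x ∷ y ∷ ys) _ _ D → All (_∉ T) _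
    avoids (_ , ⊆C) = All.anti-mono ⊆C C∩T=∅

    interiors-equal : pre ++ (_ ∷ D₁ ∷ʳ _) ++ post ≡ pre ++ (_ ∷ D₂ ∷ʳ _) ++ post → D₁ ≡ D₂
    interiors-equal eq = proj₁ (∷ʳ-injective D₁ D₂ (∷-injectiveʳ (++-cancelʳ post _ _ (++-cancelˡ pre _ _ eq))))

  InClosedNeighbourhood : Subset n → Fin n → Set
  InClosedNeighbourhood S v = v ∈ S ⊎ ∃ λ u → u ∈ S × REdge G s t u v

  module _ {S T : Subset n} (S-acyclic : ¬ CycleAvoiding G s t S)
           (N[S]⊆T : ∀ v → InClosedNeighbourhood S v → v ∈ T) where

    private
      ∉T⇒∉S : ∀ {v} → v ∉ T → v ∉ S
      ∉T⇒∉S v∉T v∈S = v∉T (N[S]⊆T _ (inj₁ v∈S))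

      no-cycle-within : ∀ {L} → (∃₂ λ x xs → IsCycle (REdge G s t) x xs × x ∷ xs ⊆ L) → ¬ All (_∉ S) L
      no-cycle-within (x , xs , (len , uniq , closed) , ⊆L) L∩S=∅ =
        S-acyclic (x , xs , len , uniq , closed , All.anti-mono ⊆L L∩S=∅)

      trace-head : ∀ {u Q} → u ∈ S → Linked (REdge G s t) (u ∷ Q) → head (trace G T Q) ≡ head Q
      trace-head {Q = []} _ _ = refl
      trace-head {u} {a ∷ _} u∈S (ua ∷ _) = cong head (filter-accept (_∈? T) (N[S]⊆T a (inj₂ (u , u∈S , ua))))

      T-free-before-S⇒[] : ∀ {u} X {y W} → y ∈ S → Linked (REdge G s t) (u ∷ X ++ y ∷ W) →
                           All (_∉ T) X → X ≡ []
      T-free-before-S⇒[] [] _ _ _ = refl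
      T-free-before-S⇒[] (x ∷ []) {y} y∈S (_ ∷ xy ∷ _) (x∉T ∷ []) =
        contradiction (N[S]⊆T x (inj₂ (y , y∈S , REdge-sym xy))) x∉T
      T-free-before-S⇒[] (x ∷ x′ ∷ X) y∈S (_ ∷ walk) (_ ∷ X∩T=∅) with T-free-before-S⇒[] (x′ ∷ X) y∈S walk X∩T=∅
      ... | ()

      common-first-T⇒⊥ : ∀ {u X₁ X₂ y W₁ W₂} → u ∉ S →
                         SimpleWalk (REdge G s t) (u ∷ X₁ ++ y ∷ W₁) →
                         SimpleWalk (REdge G s t) (u ∷ X₂ ++ y ∷ W₂) →
                         head (X₁ ++ y ∷ W₁) ≢ head (X₂ ++ y ∷ W₂) →
                         All (_∉ T) X₁ → All (_∉ T) X₂ → ⊥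
      common-first-T⇒⊥ {u} {X₁} {X₂} {y} u∉S w₁ w₂ heads≢ X₁∩T=∅ X₂∩T=∅ with y ∈? S
      ... | yes y∈S
        with T-free-before-S⇒[] X₁ y∈S (proj₂ w₁) X₁∩T=∅ | T-free-before-S⇒[] X₂ y∈S (proj₂ w₂) X₂∩T=∅
      ...   | refl | refl = heads≢ refl
      common-first-T⇒⊥ {u} {X₁} {X₂} u∉S w₁ w₂ heads≢ X₁∩T=∅ X₂∩T=∅ | no y∉S =
        no-cycle-within
          (rejoiningWalks⇒cycle REdge-sym _≟ᶠ_
            (proj₁ (SimpleWalk-++⁻ (u ∷ X₁) w₁)) (proj₁ (SimpleWalk-++⁻ (u ∷ X₂) w₂))
            (λ eq → heads≢ (trans (head-++-∷ X₁) (trans eq (head-++-∷ X₂))))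
            (∈-++⁺ʳ X₁ (here refl)) (∈-++⁺ʳ X₂ (here refl)))
          (u∉S ∷ All.++⁺ (All.∷ʳ⁺ (All.map ∉T⇒∉S X₁∩T=∅) y∉S) (All.∷ʳ⁺ (All.map ∉T⇒∉S X₂∩T=∅) y∉S))

    forkedWalks-trace≢ : ∀ {u Q₁ Q₂ e} →
                         SimpleWalk (REdge G s t) (u ∷ Q₁) → SimpleWalk (REdge G s t) (u ∷ Q₂) →
                         head Q₁ ≢ head Q₂ → last Q₁ ≡ just e → last Q₂ ≡ just e →
                         trace G T Q₁ ≢ trace G T Q₂
    forkedWalks-trace≢ {u} {Q₁} {Q₂} w₁ w₂ heads≢ ends₁ ends₂ traces≡ with u ∈? S
    ... | yes u∈S =
      heads≢ (trans (sym (trace-head u∈S (proj₂ w₁))) (trans (cong head traces≡) (trace-head u∈S (proj₂ w₂))))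
    ... | no u∉S with firstView? (_∈? T) Q₁ | firstView? (_∈? T) Q₂
    ...   | inj₂ Q₁∩T=∅ | inj₂ Q₂∩T=∅ =
      no-cycle-within (rejoiningWalks⇒cycle REdge-sym _≟ᶠ_ w₁ w₂ heads≢ (last-∈ ends₁) (last-∈ ends₂))
        (u∉S ∷ All.++⁺ (All.map ∉T⇒∉S Q₁∩T=∅) (All.map ∉T⇒∉S Q₂∩T=∅))
    ...   | inj₂ Q₁∩T=∅ | inj₁ (firstAt X₂∩T=∅ y∈T W₂) =
      contradiction (trans (sym (filter-none (_∈? T) Q₁∩T=∅)) (trans traces≡ (trace-firstAt T W₂ X₂∩T=∅ y∈T)))
        λ ()
    ...   | inj₁ (firstAt X₁∩T=∅ y∈T W₁) | inj₂ Q₂∩T=∅ =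
      contradiction (trans (sym (filter-none (_∈? T) Q₂∩T=∅)) (trans (sym traces≡) (trace-firstAt T W₁ X₁∩T=∅ y∈T)))
        λ ()
    ...   | inj₁ (firstAt X₁∩T=∅ y₁∈T W₁) | inj₁ (firstAt X₂∩T=∅ y₂∈T W₂)
      with ∷-injectiveˡ
             (trans (sym (trace-firstAt T W₁ X₁∩T=∅ y₁∈T)) (trans traces≡ (trace-firstAt T W₂ X₂∩T=∅ y₂∈T)))
    ...     | refl = common-first-T⇒⊥ u∉S w₁ w₂ heads≢ X₁∩T=∅ X₂∩T=∅

    closedNeighbourhood-tracking : IsTrackingSet G s t T
    closedNeighbourhood-tracking P₁ P₂ path₁@(uniq₁ , _ , starts₁ , ends₁) path₂@(uniq₂ , _ , starts₂ , ends₂)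
                                 P₁≢P₂ traces≡
      with diverge _≟ᶠ_ P₁≢P₂ (trans starts₁ (sym starts₂)) (trans ends₁ (sym ends₂)) uniq₁ uniq₂
    ... | fork pre u a≢b R₁ R₂ =
      forkedWalks-trace≢ (suffix path₁) (suffix path₂) (a≢b ∘ just-injective)
        (trans (sym (last-++-∷ pre)) ends₁) (trans (sym (last-++-∷ pre)) ends₂)
        (trace-∷-cancel T u (trace-cancel T pre traces≡))
      where
      suffix : ∀ {Q} → IsPath G s t (pre ++ u ∷ Q) → SimpleWalk (REdge G s t) (u ∷ Q)
      suffix path = proj₂ (SimpleWalk-++⁻ pre (path⇒REdge-walk path))

  closedNeighbourhood-size : ∀ δ → (∀ v → degree G v ≤ δ) → ∀ {S T} →
                             (∀ v → v ∈ T → InClosedNeighbourhood S v) → ∣ T ∣ ≤ ∣ S ∣ * suc δ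
  closedNeighbourhood-size δ deg≤δ T⊆N[S] = cover-bound N[_] ∣N[u]∣≤1+δ (covered ∘ T⊆N[S] _)
    where
    N[_] : Fin n → Subset n
    N[ u ] = ⁅ u ⁆ ∪ tabulate (Graph.adj G u)

    ∣N[u]∣≤1+δ : ∀ u → ∣ N[ u ] ∣ ≤ suc δ
    ∣N[u]∣≤1+δ u = ≤-trans (∣p∪q∣≤∣p∣+∣q∣ ⁅ u ⁆ _)
                     (subst (λ m → m + degree G u ≤ suc δ) (sym (∣⁅x⁆∣≡1 u)) (s≤s (deg≤δ u)))

    covered : ∀ {S v} → InClosedNeighbourhood S v → ∃ λ u → u ∈ S × v ∈ N[ u ]
    covered {v = v} (inj₁ v∈S) = v , v∈S , x∈p∪q⁺ (inj₁ (x∈⁅x⁆ v))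
    covered (inj₂ (u , u∈S , uv)) = u , u∈S , x∈p∪q⁺ (inj₂ (∈-tabulate⁺ (Graph.adj G u) (REdge⇒Adj uv)))

  -- Membership in the reduced graph is not decided here; the ¬¬ suffices because the bound it feeds is decidable.
  tracking⇒smallFVS : ∀ {T′} → IsTrackingSet G s t T′ → ¬ ¬ (∃ λ S′ → IsFVS G s t S′ × ∣ S′ ∣ ≤ ∣ T′ ∣)
  tracking⇒smallFVS {T′} tracking = ¬¬-map smallFVS (¬¬-decidable (RVert G s t))
    where
    smallFVS : Decidable (RVert G s t) → ∃ λ S′ → IsFVS G s t S′ × ∣ S′ ∣ ≤ ∣ T′ ∣
    smallFVS RVert? = T′ ∩ R , (T′∩R⊆RVert , acyclic) , ∣p∩q∣≤∣p∣ T′ R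
      where
      R : Subset n
      R = tabulate (does ∘ RVert?)

      ∈R⁻ : ∀ {v} → v ∈ R → RVert G s t v
      ∈R⁻ {v} v∈R with RVert? v | ∈-tabulate⁻ (does ∘ RVert?) v∈R
      ... | yes r | _ = r

      T′∩R⊆RVert : ∀ v → v ∈ T′ ∩ R → RVert G s t v
      T′∩R⊆RVert v v∈ = ∈R⁻ (proj₂ (x∈p∩q⁻ T′ R v∈))

      acyclic : ¬ CycleAvoiding G s t (T′ ∩ R)
      acyclic (x , xs , len , uniq , closed , C∩S′=∅) =
        tracking⇒meetsCycles tracking (len , uniq , closed) (All.zipWith avoids (reduced , C∩S′=∅))
        where
        reduced : All (RVert G s t) (x ∷ xs)
        reduced = All.map (REdge⇒RVert ∘ proj₂) (Linked-∷ʳ⇒sources (x ∷ xs) closed)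
        avoids : ∀ {v} → RVert G s t v × v ∉ T′ ∩ R → v ∉ T′
        avoids {v} (r , v∉S′) v∈T′ =
          v∉S′ (x∈p∩q⁺ (v∈T′ , ∈-tabulate⁺ (does ∘ RVert?) (dec-true (RVert? v) r)))

lemma9 : ∀ {n} (G : Graph n) (s t : Fin n) (δ : ℕ) →
           (∀ v → degree G v ≤ δ) →
           (S : Subset n) → IsFVS G s t S →
           (∀ S′ → IsFVS G s t S′ → ∣ S ∣ ≤ 2 * ∣ S′ ∣) →
           (T : Subset n) →
           (∀ v → v ∈ T ⇔ (v ∈ S ⊎ ∃ λ u → u ∈ S × REdge G s t u v)) →
           IsTrackingSet G s t T ×
           (∀ T′ → IsTrackingSet G s t T′ → ∣ T ∣ ≤ 2 * (δ + 1) * ∣ T′ ∣)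
lemma9 G s t δ deg≤δ S (_ , S-acyclic) S-approx T T≡N[S] =
  closedNeighbourhood-tracking G s t S-acyclic (Equivalence.from ∘ T≡N[S]) , T-bound
  where
  T-bound : ∀ T′ → IsTrackingSet G s t T′ → ∣ T ∣ ≤ 2 * (δ + 1) * ∣ T′ ∣
  T-bound T′ tracking = begin
    ∣ T ∣                ≤⟨ closedNeighbourhood-size G s t δ deg≤δ (Equivalence.to ∘ T≡N[S]) ⟩
    ∣ S ∣ * suc δ        ≤⟨ *-monoˡ-≤ (suc δ) ∣S∣≤2∣T′∣ ⟩
    2 * ∣ T′ ∣ * suc δ   ≡⟨ rearrange ∣ T′ ∣ δ ⟩
    2 * (δ + 1) * ∣ T′ ∣ ∎
    where
    open ≤-Reasoning
    rearrange : ∀ a d → 2 * a * suc d ≡ 2 * (d + 1) * a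
    rearrange = solve-∀
    ∣S∣≤2∣T′∣ : ∣ S ∣ ≤ 2 * ∣ T′ ∣
    ∣S∣≤2∣T′∣ = decidable-stable (∣ S ∣ ≤? 2 * ∣ T′ ∣)
      (¬¬-map (λ (S′ , S′-fvs , ∣S′∣≤∣T′∣) → ≤-trans (S-approx S′ S′-fvs) (*-monoʳ-≤ 2 ∣S′∣≤∣T′∣))
              (tracking⇒smallFVS G s t tracking))
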